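{- Let $k\ge 3$ and $n\ge 2$ be integers and let $\mathcal{H}_{k,n}$ be the hinge graph obtained by gluing $n$ copies of the $k$-cycle along one common edge $xy$. Consider the following degree-zero divisors on $\mathcal{H}_{k,n}$: (i) $\delta_{x,y}$, which assigns $1$ to one shared vertex and $-1$ to the other shared vertex, and $0$ elsewhere; (ii) $\epsilon_{x,y}$, which assigns $1$ and $-1$ to a shared vertex and to a non-shared vertex adjacent to it on one of the cycles (in either order), and $0$ elsewhere; (iii) $\eta_{x,y}$, which assigns $1$ and $-1$ to two non-shared vertices that are adjacent to the same shared vertex but lie on different cycles, and $0$ elsewhere. Then, as elements of the critical group $K(\mathcal{H}_{k,n})$, the orders of $\eta_{x,y}$, $\delta_{x,y}$ and $\epsilon_{x,y}$ are $k-1$, $k+n-1$ and $(k-1)(k+n-1)$, respectively.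
   Context: The hinge graph $\mathcal{H}_{k,n}$ is the simple graph with two distinguished ("shared") vertices $x,y$ joined by an edge $xy$, together with $n$ internally vertex-disjoint paths from $x$ to $y$, each having $k-2$ internal vertices (so each path together with the edge $xy$ forms a $k$-cycle, called a cycle or base shape of the hinge graph). A divisor is a formal $\mathbb{Z}$-linear combination of vertices; firing a vertex $w$ decreases its value by its valence and increases each neighbor's value by $1$; two divisors are linearly equivalent if their difference lies in the image of the graph Laplacian (i.e., one is obtained from the other by firings and inverse firings). The critical group $K(G)$ is the group of degree-zero divisors modulo linear equivalence. The order of a divisor $D$ is the smallest positive integer $z$ such that $zD$ is linearly equivalent to the zero divisor. -}

module Defs where

open import Data.Nat as ℕ using (ℕ; zero; suc; _<_)
open import Data.Fin as Fin using (Fin; toℕ)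
open import Data.Bool using (Bool; true; false; if_then_else_; _∧_; _∨_)
open import Data.Integer as ℤ using (ℤ; +_; _-_)
open import Data.Product using (_×_; ∃)
open import Data.Sum using (_⊎_)
open import Relation.Binary.PropositionalEquality using (_≡_)
open import Relation.Nullary.Decidable using (⌊_⌋)

-- Vertices of the hinge graph H_{k,n} with m = k - 2 internal vertices per path:
-- the two shared vertices sx, sy and the internal vertex inner i j
-- (the j-th internal vertex of the i-th x–y path, counted from x).
data HV (n m : ℕ) : Set where
  sx sy : HV n m
  inner : Fin n → Fin m → HV n m

adj : ∀ {n m} → HV n m → HV n m → Bool
adj sx sx = false
adj sy sy = false
adj sx sy = true
adj sy sx = true
adj {m = m} sx (inner i j) = ⌊ toℕ j ℕ.≟ 0 ⌋
adj {m = m} sy (inner i j) = ⌊ suc (toℕ j) ℕ.≟ m ⌋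
adj {m = m} (inner i j) sx = ⌊ toℕ j ℕ.≟ 0 ⌋
adj {m = m} (inner i j) sy = ⌊ suc (toℕ j) ℕ.≟ m ⌋
adj (inner i j) (inner i' j') =
  ⌊ i Fin.≟ i' ⌋ ∧ (⌊ suc (toℕ j) ℕ.≟ toℕ j' ⌋ ∨ ⌊ suc (toℕ j') ℕ.≟ toℕ j ⌋)

eqV : ∀ {n m} → HV n m → HV n m → Bool
eqV sx sx = true
eqV sy sy = true
eqV (inner i j) (inner i' j') = ⌊ i Fin.≟ i' ⌋ ∧ ⌊ j Fin.≟ j' ⌋
eqV _ _ = false

sumFin : (n : ℕ) → (Fin n → ℤ) → ℤ
sumFin zero f = + 0
sumFin (suc n) f = f Fin.zero ℤ.+ sumFin n (λ i → f (Fin.suc i))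

sumV : ∀ {n m} → (HV n m → ℤ) → ℤ
sumV {n} {m} f = f sx ℤ.+ f sy ℤ.+ sumFin n (λ i → sumFin m (λ j → f (inner i j)))

Divisor : ℕ → ℕ → Set
Divisor n m = HV n m → ℤ

laplacian : ∀ {n m} → (HV n m → ℤ) → Divisor n m
laplacian f v = sumV (λ u → if adj v u then f v - f u else + 0)

_∼_ : ∀ {n m} → Divisor n m → Divisor n m → Set
_∼_ {n} {m} D D' = ∃ λ (f : HV n m → ℤ) → ∀ v → D v - D' v ≡ laplacian f v

zeroDiv : ∀ {n m} → Divisor n m
zeroDiv _ = + 0

scale : ∀ {n m} → ℕ → Divisor n m → Divisor n m
scale z D v = + z ℤ.* D v

pt : ∀ {n m} → HV n m → Divisor n m
pt a v = if eqV a v then + 1 else + 0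

diff : ∀ {n m} → HV n m → HV n m → Divisor n m
diff a b v = pt a v - pt b v

IsOrder : ∀ {n m} → Divisor n m → ℕ → Set
IsOrder D z = (0 < z) × (scale z D ∼ zeroDiv)
              × (∀ z' → 0 < z' → scale z' D ∼ zeroDiv → z ℕ.≤ z')

IsShared : ∀ {n m} → HV n m → Set
IsShared s = (s ≡ sx) ⊎ (s ≡ sy)

-- Write ℓ = k − 1 for the number of edges of each x–y path. The firing scripts are built from
-- three potentials that are affine along the paths: `descent`, falling from ℓ at x to 0 at y
-- along every path, has Laplacian (ℓ + n)(x − y); `pathDescent l` and `pathAscent l`, supported
-- on the interior of path l, have Laplacians ℓe − (ℓ − 1)x − y and ℓe′ − x − (ℓ − 1)y, where e
-- and e′ are the vertices of path l next to x and y. Linear combinations of these annihilate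
-- (ℓ + n)δ, ℓη and ℓ(ℓ + n)ε.
-- For minimality, the Laplacian is self-adjoint for the pairing ⟪ D , φ ⟫ = Σ D(v) φ(v), so
-- zD = L g and L φ = N D₀ give z ⟪ D , φ ⟫ = N ⟪ g , D₀ ⟫. Taking for φ the firing script of an
-- ε, so that N = ℓ(ℓ + n), the pairing ⟪ D , φ ⟫ is 1, ℓ and −(ℓ + n)(ℓ − 1) for D an ε on
-- another path, δ and η respectively; as ℓ − 1 and ℓ are coprime, this forces the divisibility.
module Submission where

open import Defs
open import Data.Bool using (Bool; true; false; if_then_else_; _∧_; _∨_; T)
open import Data.Bool.Properties using (∨-comm)
open import Data.Fin as Fin using (Fin; toℕ)
import Data.Fin.Properties as Fin
open import Data.Nat as ℕ using (ℕ)
import Data.Nat.Properties as ℕ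
import Data.Nat.Divisibility as ℕ
open import Data.Product using (_×_; _,_)
open import Data.Sum using (inj₁; inj₂)
open import Function using (_∘_; mk⇔)
open import Relation.Binary.Definitions using (DecidableEquality)
open import Relation.Binary.PropositionalEquality
  using (_≡_; _≢_; _≗_; refl; sym; trans; cong; cong₂; subst; subst₂; module ≡-Reasoning)
open import Relation.Nullary.Decidable
  using (⌊_⌋; does; isYes≗does; does-⇔; dec-true; dec-false; toWitness)
open import Relation.Nullary.Negation using (contradiction)

1+n∣m*n⇒1+n∣m : ∀ {n m} → ℕ.suc n ℕ.∣ m ℕ.* n → ℕ.suc n ℕ.∣ m
1+n∣m*n⇒1+n∣m {n} {m} 1+n∣m*n = ℕ.∣m+n∣m⇒∣n
  (subst (ℕ.suc n ℕ.∣_) (trans (ℕ.*-suc m n) (ℕ.+-comm m (m ℕ.* n))) (ℕ.n∣m*n m)) 1+n∣m*n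

[1+n]*o∣m*[o*n]⇒1+n∣m : ∀ {n m o} .{{_ : ℕ.NonZero o}} →
  ℕ.suc n ℕ.* o ℕ.∣ m ℕ.* (o ℕ.* n) → ℕ.suc n ℕ.∣ m
[1+n]*o∣m*[o*n]⇒1+n∣m {n} {m} {o} [1+n]*o∣m*[o*n] =
  1+n∣m*n⇒1+n∣m (ℕ.*-cancelˡ-∣ o (subst₂ ℕ._∣_ (ℕ.*-comm (ℕ.suc n) o) regroup [1+n]*o∣m*[o*n]))
  where
  regroup : m ℕ.* (o ℕ.* n) ≡ o ℕ.* (m ℕ.* n)
  regroup = trans (sym (ℕ.*-assoc m o n)) (trans (cong (ℕ._* n) (ℕ.*-comm m o)) (ℕ.*-assoc o m n))

module _ where
  open import Data.Integer using (ℤ; +_; -_; _+_; _*_; _-_; -1ℤ; ∣_∣)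
  open import Data.Integer.Properties using
    ( +-*-semiring; +-identityˡ; +-identityʳ; *-identityˡ; *-zeroʳ; *-comm; *-assoc
    ; neg-involutive; abs-*; pos-*; ∣-i∣≡∣i∣)
  open import Data.Integer.Tactic.RingSolver using (solve-∀)
  open import Algebra.Properties.Semiring.Sum +-*-semiring
    using (sum; sum-cong-≗; ∑-distrib-+; ∑-comm; sum-replicate-zero; *-distribˡ-sum)

  indicator : Bool → ℤ
  indicator b = if b then + 1 else + 0

  isYes-≟-sym : ∀ {a} {A : Set a} (_≟_ : DecidableEquality A) (x y : A) →
    ⌊ x ≟ y ⌋ ≡ does (y ≟ x)
  isYes-≟-sym _≟_ x y = trans (isYes≗does (x ≟ y)) (does-⇔ (mk⇔ sym sym) (x ≟ y) (y ≟ x))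

  sumFin≡sum : ∀ n (f : Fin n → ℤ) → sumFin n f ≡ sum f
  sumFin≡sum ℕ.zero    f = refl
  sumFin≡sum (ℕ.suc n) f = cong (_+_ (f Fin.zero)) (sumFin≡sum n (f ∘ Fin.suc))

  sumFin-cong : ∀ n {f g : Fin n → ℤ} → f ≗ g → sumFin n f ≡ sumFin n g
  sumFin-cong n {f} {g} f≗g rewrite sumFin≡sum n f | sumFin≡sum n g = sum-cong-≗ f≗g

  sumFin-distrib-+ : ∀ n (f g : Fin n → ℤ) →
    sumFin n (λ i → f i + g i) ≡ sumFin n f + sumFin n g
  sumFin-distrib-+ n f g
    rewrite sumFin≡sum n (λ i → f i + g i) | sumFin≡sum n f | sumFin≡sum n g = ∑-distrib-+ f g

  *-distribˡ-sumFin : ∀ n c (f : Fin n → ℤ) → c * sumFin n f ≡ sumFin n (λ i → c * f i)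
  *-distribˡ-sumFin n c f
    rewrite sumFin≡sum n f | sumFin≡sum n (λ i → c * f i) = *-distribˡ-sum c f

  sumFin-zero : ∀ n → sumFin n (λ _ → + 0) ≡ + 0
  sumFin-zero n rewrite sumFin≡sum n (λ _ → + 0) = sum-replicate-zero n

  sumFin-comm : ∀ n m (f : Fin n → Fin m → ℤ) →
    sumFin n (λ i → sumFin m (f i)) ≡ sumFin m (λ j → sumFin n (λ i → f i j))
  sumFin-comm n m f = begin
    sumFin n (λ i → sumFin m (f i))          ≡⟨ sumFin-cong n (λ i → sumFin≡sum m (f i)) ⟩
    sumFin n (λ i → sum (f i))               ≡⟨ sumFin≡sum n (λ i → sum (f i)) ⟩
    sum (λ i → sum (f i))                    ≡⟨ ∑-comm f ⟩
    sum (λ j → sum (λ i → f i j))            ≡⟨ sumFin≡sum m (λ j → sum (λ i → f i j)) ⟨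
    sumFin m (λ j → sum (λ i → f i j))       ≡⟨ sumFin-cong m (λ j → sumFin≡sum n (λ i → f i j)) ⟨
    sumFin m (λ j → sumFin n (λ i → f i j))  ∎
    where open ≡-Reasoning

  sumFin-const : ∀ n c → sumFin n (λ _ → c) ≡ + n * c
  sumFin-const ℕ.zero    c = refl
  sumFin-const (ℕ.suc n) c = trans (cong (_+_ c) (sumFin-const n c)) (distrib (+ n) c)
    where
    distrib : ∀ N c → c + N * c ≡ (+ 1 + N) * c
    distrib = solve-∀

  sumFin-collapse : ∀ {n} (l : Fin n) (F : Bool → Fin n → ℤ) → (∀ i → F false i ≡ + 0) →
    sumFin n (λ i → F (does (l Fin.≟ i)) i) ≡ F true l
  sumFin-collapse {ℕ.suc n} Fin.zero F F-false≡0 =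
    trans (cong (_+_ (F true Fin.zero)) (trans (sumFin-cong n (F-false≡0 ∘ Fin.suc)) (sumFin-zero n)))
          (+-identityʳ (F true Fin.zero))
  sumFin-collapse {ℕ.suc n} (Fin.suc l) F F-false≡0 =
    trans (cong₂ _+_ (F-false≡0 Fin.zero) (sumFin-collapse l (λ b → F b ∘ Fin.suc) (F-false≡0 ∘ Fin.suc)))
          (+-identityˡ (F true (Fin.suc l)))

  sumFin-indicator : ∀ {n} (l : Fin n) y → sumFin n (λ i → indicator (does (l Fin.≟ i)) * y) ≡ y
  sumFin-indicator l y = trans (sumFin-collapse l (λ b _ → indicator b * y) (λ _ → refl)) (*-identityˡ y)

  sumFin-pick : ∀ {M} s (G : ℕ → ℤ) → s ℕ.< M →
    sumFin M (λ j → if s ℕ.≡ᵇ toℕ j then G (toℕ j) else + 0) ≡ G s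
  sumFin-pick {ℕ.suc M} ℕ.zero G _ =
    trans (cong (_+_ (G 0)) (sumFin-zero M)) (+-identityʳ (G 0))
  sumFin-pick {ℕ.suc M} (ℕ.suc s) G (ℕ.s≤s s<M) =
    trans (+-identityˡ _) (sumFin-pick s (G ∘ ℕ.suc) s<M)

  sumFin-pick-none : ∀ {M} s (G : ℕ → ℤ) → M ℕ.≤ s →
    sumFin M (λ j → if s ℕ.≡ᵇ toℕ j then G (toℕ j) else + 0) ≡ + 0
  sumFin-pick-none {ℕ.zero}  s         G _ = refl
  sumFin-pick-none {ℕ.suc M} (ℕ.suc s) G (ℕ.s≤s M≤s) =
    trans (+-identityˡ _) (sumFin-pick-none s (G ∘ ℕ.suc) M≤s)

  if-∨-split : ∀ b c x → b ∧ c ≡ false →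
    (if b ∨ c then x else + 0) ≡ (if b then x else + 0) + (if c then x else + 0)
  if-∨-split true  false x _ = sym (+-identityʳ x)
  if-∨-split false true  x _ = sym (+-identityˡ x)
  if-∨-split false false x _ = refl

  -- The Laplacian and the pairing of divisors with potentials

  module _ {n m : ℕ} where

    inners : (HV n m → ℤ) → ℤ
    inners f = sumFin n (λ i → sumFin m (λ j → f (inner i j)))

    inners-cong : {f g : HV n m → ℤ} → f ≗ g → inners f ≡ inners g
    inners-cong f≗g = sumFin-cong n (λ i → sumFin-cong m (λ j → f≗g (inner i j)))

    inners-zero : inners (λ _ → + 0) ≡ + 0
    inners-zero = trans (sumFin-cong n (λ _ → sumFin-zero m)) (sumFin-zero n)

    inners-distrib-+ : (f g : HV n m → ℤ) → inners (λ v → f v + g v) ≡ inners f + inners g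
    inners-distrib-+ f g = trans
      (sumFin-cong n (λ i → sumFin-distrib-+ m (λ j → f (inner i j)) (λ j → g (inner i j))))
      (sumFin-distrib-+ n (λ i → sumFin m (λ j → f (inner i j))) (λ i → sumFin m (λ j → g (inner i j))))

    *-distribˡ-inners : ∀ c (f : HV n m → ℤ) → c * inners f ≡ inners (λ v → c * f v)
    *-distribˡ-inners c f = trans (*-distribˡ-sumFin n c (λ i → sumFin m (λ j → f (inner i j))))
      (sumFin-cong n (λ i → *-distribˡ-sumFin m c (λ j → f (inner i j))))

    inners-comm : (h : HV n m → HV n m → ℤ) →
      inners (λ v → inners (h v)) ≡ inners (λ u → inners (λ v → h v u))
    inners-comm h = begin
      sumFin n (λ i → sumFin m (λ j → sumFin n (λ i′ → sumFin m (λ j′ → H i j i′ j′))))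
        ≡⟨ sumFin-cong n (λ i → sumFin-comm m n (λ j i′ → sumFin m (H i j i′))) ⟩
      sumFin n (λ i → sumFin n (λ i′ → sumFin m (λ j → sumFin m (λ j′ → H i j i′ j′))))
        ≡⟨ sumFin-comm n n (λ i i′ → sumFin m (λ j → sumFin m (λ j′ → H i j i′ j′))) ⟩
      sumFin n (λ i′ → sumFin n (λ i → sumFin m (λ j → sumFin m (λ j′ → H i j i′ j′))))
        ≡⟨ sumFin-cong n (λ i′ → sumFin-cong n (λ i → sumFin-comm m m (λ j j′ → H i j i′ j′))) ⟩
      sumFin n (λ i′ → sumFin n (λ i → sumFin m (λ j′ → sumFin m (λ j → H i j i′ j′))))
        ≡⟨ sumFin-cong n (λ i′ → sumFin-comm n m (λ i j′ → sumFin m (λ j → H i j i′ j′))) ⟩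
      sumFin n (λ i′ → sumFin m (λ j′ → sumFin n (λ i → sumFin m (λ j → H i j i′ j′)))) ∎
      where
      open ≡-Reasoning
      H : Fin n → Fin m → Fin n → Fin m → ℤ
      H i j i′ j′ = h (inner i j) (inner i′ j′)

    sumV-cong : {f g : HV n m → ℤ} → f ≗ g → sumV f ≡ sumV g
    sumV-cong f≗g = cong₂ _+_ (cong₂ _+_ (f≗g sx) (f≗g sy)) (inners-cong f≗g)

    sumV-distrib-+ : (f g : HV n m → ℤ) → sumV (λ v → f v + g v) ≡ sumV f + sumV g
    sumV-distrib-+ f g = trans (cong (_+_ ((f sx + g sx) + (f sy + g sy))) (inners-distrib-+ f g))
                               (regroup (f sx) (f sy) (inners f) (g sx) (g sy) (inners g))
      where
      regroup : ∀ a b c a′ b′ c′ → (a + a′) + (b + b′) + (c + c′) ≡ (a + b + c) + (a′ + b′ + c′)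
      regroup = solve-∀

    *-distribˡ-sumV : ∀ c (f : HV n m → ℤ) → c * sumV f ≡ sumV (λ v → c * f v)
    *-distribˡ-sumV c f = trans (distrib c (f sx) (f sy) (inners f))
                                (cong (_+_ (c * f sx + c * f sy)) (*-distribˡ-inners c f))
      where
      distrib : ∀ c a b d → c * (a + b + d) ≡ c * a + c * b + c * d
      distrib = solve-∀

    sumV-comm : (h : HV n m → HV n m → ℤ) →
      sumV (λ v → sumV (h v)) ≡ sumV (λ u → sumV (λ v → h v u))
    sumV-comm h = begin
      sumV (h sx) + sumV (h sy) + inners (λ v → sumV (h v))
        ≡⟨ cong (_+_ (sumV (h sx) + sumV (h sy))) inners-sumV ⟩
      sumV (h sx) + sumV (h sy) + sumV (λ u → inners (λ v → h v u))
        ≡⟨ cong (_+ sumV (λ u → inners (λ v → h v u))) (sumV-distrib-+ (h sx) (h sy)) ⟨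
      sumV (λ u → h sx u + h sy u) + sumV (λ u → inners (λ v → h v u))
        ≡⟨ sumV-distrib-+ (λ u → h sx u + h sy u) (λ u → inners (λ v → h v u)) ⟨
      sumV (λ u → h sx u + h sy u + inners (λ v → h v u)) ∎
      where
      open ≡-Reasoning
      inners-sumV : inners (λ v → sumV (h v)) ≡ sumV (λ u → inners (λ v → h v u))
      inners-sumV = trans (inners-distrib-+ (λ v → h v sx + h v sy) (λ v → inners (h v)))
        (cong₂ _+_ (inners-distrib-+ (λ v → h v sx) (λ v → h v sy)) (inners-comm h))

    adj-sym : (u v : HV n m) → adj u v ≡ adj v u
    adj-sym sx sx = refl
    adj-sym sx sy = refl
    adj-sym sy sx = refl
    adj-sym sy sy = refl
    adj-sym sx (inner i j) = refl
    adj-sym sy (inner i j) = refl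
    adj-sym (inner i j) sx = refl
    adj-sym (inner i j) sy = refl
    adj-sym (inner i j) (inner i′ j′) = cong₂ _∧_
      (trans (isYes-≟-sym Fin._≟_ i i′) (sym (isYes≗does (i′ Fin.≟ i))))
      (∨-comm ⌊ ℕ.suc (toℕ j) ℕ.≟ toℕ j′ ⌋ ⌊ ℕ.suc (toℕ j′) ℕ.≟ toℕ j ⌋)

    ⟪_,_⟫ : (HV n m → ℤ) → (HV n m → ℤ) → ℤ
    ⟪ f , g ⟫ = sumV (λ v → f v * g v)

    ⟪,⟫-comm : (f g : HV n m → ℤ) → ⟪ f , g ⟫ ≡ ⟪ g , f ⟫
    ⟪,⟫-comm f g = sumV-cong (λ v → *-comm (f v) (g v))

    adjacencyForm degreeForm : (HV n m → ℤ) → (HV n m → ℤ) → ℤ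
    adjacencyForm f g = sumV (λ v → sumV (λ u → if adj v u then f v * g u else + 0))
    degreeForm    f g = sumV (λ v → sumV (λ u → if adj v u then f v * g v else + 0))

    adjacencyForm-comm : (f g : HV n m → ℤ) → adjacencyForm f g ≡ adjacencyForm g f
    adjacencyForm-comm f g = trans (sumV-comm (λ v u → if adj v u then f v * g u else + 0))
      (sumV-cong λ u → sumV-cong λ v →
        cong₂ (λ b x → if b then x else + 0) (adj-sym v u) (*-comm (f v) (g u)))

    degreeForm-comm : (f g : HV n m → ℤ) → degreeForm f g ≡ degreeForm g f
    degreeForm-comm f g = sumV-cong λ v → sumV-cong λ u →
      cong (λ x → if adj v u then x else + 0) (*-comm (f v) (g v))

    ⟪,laplacian⟫ : (f g : HV n m → ℤ) → ⟪ f , laplacian g ⟫ ≡ degreeForm f g - adjacencyForm f g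
    ⟪,laplacian⟫ f g = trans (add-sub ⟪ f , laplacian g ⟫ (adjacencyForm f g))
                             (cong (_- adjacencyForm f g) completed)
      where
      open ≡-Reasoning
      add-sub : ∀ x y → x ≡ x + y - y
      add-sub = solve-∀
      term off : HV n m → HV n m → ℤ
      term v u = if adj v u then g v - g u else + 0
      off  v u = if adj v u then f v * g u else + 0
      rearrange : ∀ b x y z →
        x * (if b then y - z else + 0) + (if b then x * z else + 0) ≡ (if b then x * y else + 0)
      rearrange true  = distrib
        where distrib : ∀ x y z → x * (y - z) + x * z ≡ x * y
              distrib = solve-∀
      rearrange false x y z = trans (+-identityʳ (x * + 0)) (*-zeroʳ x)
      completed : ⟪ f , laplacian g ⟫ + adjacencyForm f g ≡ degreeForm f g
      completed = begin
        ⟪ f , laplacian g ⟫ + adjacencyForm f g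
          ≡⟨ sumV-distrib-+ (λ v → f v * laplacian g v) (λ v → sumV (off v)) ⟨
        sumV (λ v → f v * sumV (term v) + sumV (off v))
          ≡⟨ sumV-cong (λ v → trans (cong (_+ sumV (off v)) (*-distribˡ-sumV (f v) (term v)))
                                    (sym (sumV-distrib-+ (λ u → f v * term v u) (off v)))) ⟩
        sumV (λ v → sumV (λ u → f v * term v u + off v u))
          ≡⟨ sumV-cong (λ v → sumV-cong (λ u → rearrange (adj v u) (f v) (g v) (g u))) ⟩
        degreeForm f g ∎

    laplacian-selfAdjoint : (f g : HV n m → ℤ) → ⟪ laplacian f , g ⟫ ≡ ⟪ f , laplacian g ⟫
    laplacian-selfAdjoint f g = begin
      ⟪ laplacian f , g ⟫                 ≡⟨ ⟪,⟫-comm (laplacian f) g ⟩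
      ⟪ g , laplacian f ⟫                 ≡⟨ ⟪,laplacian⟫ g f ⟩
      degreeForm g f - adjacencyForm g f  ≡⟨ cong₂ _-_ (degreeForm-comm g f) (adjacencyForm-comm g f) ⟩
      degreeForm f g - adjacencyForm f g  ≡⟨ ⟪,laplacian⟫ f g ⟨
      ⟪ f , laplacian g ⟫                 ∎
      where open ≡-Reasoning

    laplacian-linear : ∀ c d (f g h : HV n m → ℤ) → (∀ u → h u ≡ c * f u + d * g u) →
      ∀ v → laplacian h v ≡ c * laplacian f v + d * laplacian g v
    laplacian-linear c d f g h h≡ v = begin
      sumV (λ u → if adj v u then h v - h u else + 0)
        ≡⟨ sumV-cong (λ u → termwise (adj v u) u) ⟩
      sumV (λ u → c * F u + d * G u)
        ≡⟨ sumV-distrib-+ (λ u → c * F u) (λ u → d * G u) ⟩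
      sumV (λ u → c * F u) + sumV (λ u → d * G u)
        ≡⟨ cong₂ _+_ (*-distribˡ-sumV c F) (*-distribˡ-sumV d G) ⟨
      c * laplacian f v + d * laplacian g v ∎
      where
      open ≡-Reasoning
      F G : HV n m → ℤ
      F u = if adj v u then f v - f u else + 0
      G u = if adj v u then g v - g u else + 0
      termwise : ∀ b u → (if b then h v - h u else + 0) ≡
        c * (if b then f v - f u else + 0) + d * (if b then g v - g u else + 0)
      termwise true  u rewrite h≡ v | h≡ u = linear c d (f v) (f u) (g v) (g u)
        where linear : ∀ c d x x′ y y′ → c * x + d * y - (c * x′ + d * y′) ≡ c * (x - x′) + d * (y - y′)
              linear = solve-∀
      termwise false u = zero c d
        where zero : ∀ c d → + 0 ≡ c * + 0 + d * + 0
              zero = solve-∀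

    laplacian-neg : (g : HV n m → ℤ) → ∀ v → laplacian (λ u → - g u) v ≡ - laplacian g v
    laplacian-neg g v = trans
      (laplacian-linear -1ℤ (+ 0) g g (λ u → - g u) (λ u → as-combination (g u)) v)
      (simplify (laplacian g v))
      where
      as-combination : ∀ x → - x ≡ -1ℤ * x + + 0 * x
      as-combination = solve-∀
      simplify : ∀ x → -1ℤ * x + + 0 * x ≡ - x
      simplify = solve-∀

    indicator-∧ : ∀ b c → indicator (b ∧ c) ≡ indicator b * indicator c
    indicator-∧ true  c = sym (*-identityˡ (indicator c))
    indicator-∧ false c = refl

    pt-inner : ∀ l j₀ i j → pt {n} {m} (inner l j₀) (inner i j) ≡
      indicator (does (l Fin.≟ i)) * indicator (does (j₀ Fin.≟ j))
    pt-inner l j₀ i j rewrite isYes≗does (l Fin.≟ i) | isYes≗does (j₀ Fin.≟ j) =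
      indicator-∧ (does (l Fin.≟ i)) (does (j₀ Fin.≟ j))

    ⟪pt,⟫ : (a : HV n m) (g : HV n m → ℤ) → ⟪ pt a , g ⟫ ≡ g a
    ⟪pt,⟫ sx g = trans (cong (_+_ (+ 1 * g sx + + 0 * g sy)) inners-zero) (simplify (g sx) (g sy))
      where simplify : ∀ x y → + 1 * x + + 0 * y + + 0 ≡ x
            simplify = solve-∀
    ⟪pt,⟫ sy g = trans (cong (_+_ (+ 0 * g sx + + 1 * g sy)) inners-zero) (simplify (g sx) (g sy))
      where simplify : ∀ x y → + 0 * x + + 1 * y + + 0 ≡ y
            simplify = solve-∀
    ⟪pt,⟫ (inner l j₀) g = begin
      + 0 + inners (λ v → pt (inner l j₀) v * g v)
        ≡⟨ +-identityˡ _ ⟩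
      inners (λ v → pt (inner l j₀) v * g v)
        ≡⟨ sumFin-cong n (λ i → sumFin-cong m (λ j → cong (_* g (inner i j)) (pt-inner l j₀ i j))) ⟩
      sumFin n (λ i → sumFin m (λ j → ι l i * ι j₀ j * g (inner i j)))
        ≡⟨ sumFin-collapse l (λ b i → sumFin m (λ j → indicator b * ι j₀ j * g (inner i j)))
                           (λ _ → sumFin-zero m) ⟩
      sumFin m (λ j → + 1 * ι j₀ j * g (inner l j))
        ≡⟨ sumFin-collapse j₀ (λ b j → + 1 * indicator b * g (inner l j)) (λ _ → refl) ⟩
      + 1 * g (inner l j₀)
        ≡⟨ *-identityˡ (g (inner l j₀)) ⟩
      g (inner l j₀) ∎
      where
      open ≡-Reasoning
      ι : ∀ {k} → Fin k → Fin k → ℤ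
      ι a b = indicator (does (a Fin.≟ b))

    ⟪diff,⟫ : (a b : HV n m) (g : HV n m → ℤ) → ⟪ diff a b , g ⟫ ≡ g a - g b
    ⟪diff,⟫ a b g = begin
      sumV (λ v → (pt a v - pt b v) * g v)
        ≡⟨ sumV-cong (λ v → split (pt a v) (pt b v) (g v)) ⟩
      sumV (λ v → pt a v * g v + -1ℤ * (pt b v * g v))
        ≡⟨ sumV-distrib-+ (λ v → pt a v * g v) (λ v → -1ℤ * (pt b v * g v)) ⟩
      ⟪ pt a , g ⟫ + sumV (λ v → -1ℤ * (pt b v * g v))
        ≡⟨ cong (_+_ ⟪ pt a , g ⟫) (*-distribˡ-sumV -1ℤ (λ v → pt b v * g v)) ⟨
      ⟪ pt a , g ⟫ + -1ℤ * ⟪ pt b , g ⟫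
        ≡⟨ cong₂ (λ x y → x + -1ℤ * y) (⟪pt,⟫ a g) (⟪pt,⟫ b g) ⟩
      g a + -1ℤ * g b
        ≡⟨ subtraction (g a) (g b) ⟩
      g a - g b ∎
      where
      open ≡-Reasoning
      split : ∀ p q x → (p - q) * x ≡ p * x + -1ℤ * (q * x)
      split = solve-∀
      subtraction : ∀ x y → x + -1ℤ * y ≡ x - y
      subtraction = solve-∀

    diff-swap : (a b v : HV n m) → diff b a v ≡ - diff a b v
    diff-swap a b v = swap (pt a v) (pt b v)
      where swap : ∀ p q → q - p ≡ - (p - q)
            swap = solve-∀

    laplacian⇒∼zeroDiv : ∀ z {D : Divisor n m} (f : HV n m → ℤ) →
      (∀ v → laplacian f v ≡ + z * D v) → scale z D ∼ zeroDiv
    laplacian⇒∼zeroDiv z {D} f L≡ = f , λ v → trans (+-identityʳ (+ z * D v)) (sym (L≡ v))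

    ∼zeroDiv-neg : ∀ z {D D′ : Divisor n m} → (∀ v → D′ v ≡ - D v) →
      scale z D ∼ zeroDiv → scale z D′ ∼ zeroDiv
    ∼zeroDiv-neg z {D} {D′} D′≡ (g , zD≡Lg) = laplacian⇒∼zeroDiv z (λ u → - g u) λ v → begin
      laplacian (λ u → - g u) v   ≡⟨ laplacian-neg g v ⟩
      - laplacian g v             ≡⟨ cong -_ (zD≡Lg v) ⟨
      - (+ z * D v - + 0)         ≡⟨ flip (+ z) (D v) ⟩
      + z * - D v                 ≡⟨ cong (_*_ (+ z)) (D′≡ v) ⟨
      + z * D′ v                  ∎
      where
      open ≡-Reasoning
      flip : ∀ z d → - (z * d - + 0) ≡ z * - d
      flip = solve-∀

    IsOrder-neg : ∀ {z} {D D′ : Divisor n m} → (∀ v → D′ v ≡ - D v) → IsOrder D z → IsOrder D′ z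
    IsOrder-neg {z} D′≡ (0<z , zD∼0 , minimal) =
      0<z , ∼zeroDiv-neg z D′≡ zD∼0 ,
      λ z′ 0<z′ z′D′∼0 → minimal z′ 0<z′ (∼zeroDiv-neg z′ (λ v → negate (D′≡ v)) z′D′∼0)
      where
      negate : ∀ {x y} → x ≡ - y → y ≡ - x
      negate {y = y} refl = sym (neg-involutive y)

    ∼zeroDiv⇒∣ : ∀ z {N} {D D₀ : Divisor n m} (φ : HV n m → ℤ) →
      (∀ v → laplacian φ v ≡ + N * D₀ v) → scale z D ∼ zeroDiv → N ℕ.∣ z ℕ.* ∣ ⟪ D , φ ⟫ ∣
    ∼zeroDiv⇒∣ z {N} {D} {D₀} φ Lφ≡ (g , zD≡Lg) = ℕ.divides ∣ ⟪ g , D₀ ⟫ ∣ (begin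
      z ℕ.* ∣ ⟪ D , φ ⟫ ∣    ≡⟨ abs-* (+ z) ⟪ D , φ ⟫ ⟨
      ∣ + z * ⟪ D , φ ⟫ ∣    ≡⟨ cong ∣_∣ pairing ⟩
      ∣ ⟪ g , D₀ ⟫ * + N ∣   ≡⟨ abs-* ⟪ g , D₀ ⟫ (+ N) ⟩
      ∣ ⟪ g , D₀ ⟫ ∣ ℕ.* N   ∎)
      where
      open ≡-Reasoning
      swap : ∀ x y w → x * (y * w) ≡ y * (x * w)
      swap = solve-∀
      pairing : + z * ⟪ D , φ ⟫ ≡ ⟪ g , D₀ ⟫ * + N
      pairing = begin
        + z * ⟪ D , φ ⟫                  ≡⟨ *-distribˡ-sumV (+ z) (λ v → D v * φ v) ⟩
        sumV (λ v → + z * (D v * φ v))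
          ≡⟨ sumV-cong (λ v → trans (sym (*-assoc (+ z) (D v) (φ v)))
                                    (cong (_* φ v) (trans (sym (+-identityʳ (+ z * D v))) (zD≡Lg v)))) ⟩
        ⟪ laplacian g , φ ⟫              ≡⟨ laplacian-selfAdjoint g φ ⟩
        ⟪ g , laplacian φ ⟫
          ≡⟨ sumV-cong (λ v → trans (cong (_*_ (g v)) (Lφ≡ v)) (swap (g v) (+ N) (D₀ v))) ⟩
        sumV (λ v → + N * (g v * D₀ v))  ≡⟨ *-distribˡ-sumV (+ N) (λ v → g v * D₀ v) ⟨
        + N * ⟪ g , D₀ ⟫                 ≡⟨ *-comm (+ N) ⟪ g , D₀ ⟫ ⟩
        ⟪ g , D₀ ⟫ * + N                 ∎

    order-criterion : ∀ {z N} {D D₀ : Divisor n m} (f φ : HV n m → ℤ) → 0 ℕ.< z →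
      (∀ v → laplacian f v ≡ + z * D v) → (∀ v → laplacian φ v ≡ + N * D₀ v) →
      (∀ z′ → N ℕ.∣ z′ ℕ.* ∣ ⟪ D , φ ⟫ ∣ → z ℕ.∣ z′) → IsOrder D z
    order-criterion {z} f φ 0<z Lf≡ Lφ≡ N∣⇒z∣ = 0<z , laplacian⇒∼zeroDiv z f Lf≡ ,
      λ z′ 0<z′ z′D∼0 → ℕ.∣⇒≤ {{ℕ.>-nonZero 0<z′}} (N∣⇒z∣ z′ (∼zeroDiv⇒∣ z′ φ Lφ≡ z′D∼0))

  -- Potentials that are affine along the paths

  stepUp∧stepDown≡false : ∀ t t′ → (ℕ.suc t ℕ.≡ᵇ t′) ∧ (t ℕ.≡ᵇ ℕ.suc t′) ≡ false
  stepUp∧stepDown≡false t t′ with ℕ.suc t ℕ.≡ᵇ t′ in up | t ℕ.≡ᵇ ℕ.suc t′ in down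
  ... | false | _     = refl
  ... | true  | false = refl
  ... | true  | true  = contradiction (trans t≡1+t′ (cong ℕ.suc (sym 1+t≡t′)))
                                      (ℕ.<⇒≢ (ℕ.m<n⇒m<1+n (ℕ.n<1+n t)))
    where
    1+t≡t′ = ℕ.≡ᵇ⇒≡ (ℕ.suc t) t′ (subst T (sym up) _)
    t≡1+t′ = ℕ.≡ᵇ⇒≡ t (ℕ.suc t′) (subst T (sym down) _)

  predecessorTerm : ∀ {M} t (q : ℕ → ℤ) a x → t ℕ.≤ M →
    (if t ℕ.≡ᵇ 0 then x - a else + 0)
      + sumFin M (λ j → if t ℕ.≡ᵇ ℕ.suc (toℕ j) then x - q (ℕ.suc (toℕ j)) else + 0)
    ≡ x - q t + indicator (t ℕ.≡ᵇ 0) * (q 0 - a)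
  predecessorTerm {M} ℕ.zero q a x _ =
    trans (cong (_+_ (x - a)) (sumFin-zero M)) (regroup x a (q 0))
    where regroup : ∀ x a q₀ → x - a + + 0 ≡ x - q₀ + + 1 * (q₀ - a)
          regroup = solve-∀
  predecessorTerm (ℕ.suc s) q a x s<M =
    trans (cong (_+_ (+ 0)) (sumFin-pick s (λ t → x - q (ℕ.suc t)) s<M)) (regroup x (q (ℕ.suc s)) (q 0 - a))
    where regroup : ∀ x q₁ d → + 0 + (x - q₁) ≡ x - q₁ + + 0 * d
          regroup = solve-∀

  successorTerm : ∀ {m} t (q : ℕ → ℤ) b x → t ℕ.< ℕ.suc m →
    (if t ℕ.≡ᵇ m then x - b else + 0)
      + sumFin (ℕ.suc m) (λ j → if ℕ.suc t ℕ.≡ᵇ toℕ j then x - q (ℕ.suc (toℕ j)) else + 0)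
    ≡ x - q (ℕ.suc (ℕ.suc t)) + indicator (t ℕ.≡ᵇ m) * (q (ℕ.suc (ℕ.suc m)) - b)
  successorTerm {m} t q b x t<1+m with ℕ.m<1+n⇒m<n∨m≡n t<1+m
  ... | inj₁ t<m rewrite dec-false (t ℕ.≟ m) (ℕ.<⇒≢ t<m) =
    trans (cong (_+_ (+ 0)) (sumFin-pick (ℕ.suc t) (λ t′ → x - q (ℕ.suc t′)) (ℕ.s≤s t<m)))
          (regroup x (q (ℕ.suc (ℕ.suc t))) (q (ℕ.suc (ℕ.suc m)) - b))
    where regroup : ∀ x q₁ d → + 0 + (x - q₁) ≡ x - q₁ + + 0 * d
          regroup = solve-∀
  ... | inj₂ refl rewrite dec-true (m ℕ.≟ m) refl =
    trans (cong (_+_ (x - b)) (sumFin-pick-none (ℕ.suc m) (λ t′ → x - q (ℕ.suc t′)) ℕ.≤-refl))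
          (regroup x b (q (ℕ.suc (ℕ.suc m))))
    where regroup : ∀ x b q₂ → x - b + + 0 ≡ x - q₂ + + 1 * (q₂ - b)
          regroup = solve-∀

  module _ {n m : ℕ} where

    -- Vertex inner i j is the (toℕ j + 1)-th vertex of path i, x being its 0-th vertex and y its
    -- (m + 2)-th.
    pathPotential : ℤ → ℤ → (Fin n → ℕ → ℤ) → HV n (ℕ.suc m) → ℤ
    pathPotential a b p sx          = a
    pathPotential a b p sy          = b
    pathPotential a b p (inner i j) = p i (ℕ.suc (toℕ j))

    firstInner lastInner : Fin n → HV n (ℕ.suc m)
    firstInner i = inner i Fin.zero
    lastInner  i = inner i (Fin.fromℕ m)

    pathPotential-lastInner : ∀ a b p i → pathPotential a b p (lastInner i) ≡ p i (ℕ.suc m)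
    pathPotential-lastInner a b p i = cong (λ t → p i (ℕ.suc t)) (Fin.toℕ-fromℕ m)

    isFirst : (j : Fin (ℕ.suc m)) → does (Fin.zero Fin.≟ j) ≡ (toℕ j ℕ.≡ᵇ 0)
    isFirst Fin.zero    = refl
    isFirst (Fin.suc j) = refl

    isLast : (j : Fin (ℕ.suc m)) → does (Fin.fromℕ m Fin.≟ j) ≡ (toℕ j ℕ.≡ᵇ m)
    isLast j = does-⇔ (mk⇔ to from) (Fin.fromℕ m Fin.≟ j) (toℕ j ℕ.≟ m)
      where
      to : Fin.fromℕ m ≡ j → toℕ j ≡ m
      to refl = Fin.toℕ-fromℕ m
      from : toℕ j ≡ m → Fin.fromℕ m ≡ j
      from e = Fin.toℕ-injective (trans (Fin.toℕ-fromℕ m) (sym e))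

    adj-sx-inner⇒zero : ∀ i {j} → adj {n} {ℕ.suc m} sx (inner i j) ≡ true → j ≡ Fin.zero
    adj-sx-inner⇒zero i {Fin.zero} _ = refl

    adj-sy-inner⇒last : ∀ i {j} → adj {n} {ℕ.suc m} sy (inner i j) ≡ true → j ≡ Fin.fromℕ m
    adj-sy-inner⇒last i adjacent = Fin.toℕ-injective
      (trans (ℕ.suc-injective (toWitness (subst T (sym adjacent) _))) (sym (Fin.toℕ-fromℕ m)))

    laplacian-sx : (f : HV n (ℕ.suc m) → ℤ) →
      laplacian f sx ≡ f sx - f sy + sumFin n (λ i → f sx - f (firstInner i))
    laplacian-sx f = cong₂ _+_ (+-identityˡ (f sx - f sy)) (sumFin-cong n λ i →
      trans (cong (_+_ (f sx - f (firstInner i))) (sumFin-zero m)) (+-identityʳ (f sx - f (firstInner i))))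

    laplacian-sy : (f : HV n (ℕ.suc m) → ℤ) →
      laplacian f sy ≡ f sy - f sx + sumFin n (λ i → f sy - f (lastInner i))
    laplacian-sy f = cong₂ _+_ (+-identityʳ (f sy - f sx)) (sumFin-cong n λ i →
      trans (sumFin-cong (ℕ.suc m) (λ j →
              cong (λ c → if c then f sy - f (inner i j) else + 0)
                   (trans (isYes≗does (ℕ.suc (toℕ j) ℕ.≟ ℕ.suc m)) (sym (isLast j)))))
            (sumFin-collapse (Fin.fromℕ m) (λ c j → if c then f sy - f (inner i j) else + 0) (λ _ → refl)))

    laplacian-pathPotential-sy : ∀ a b p →
      laplacian (pathPotential a b p) sy ≡ b - a + sumFin n (λ i → b - p i (ℕ.suc m))
    laplacian-pathPotential-sy a b p = trans (laplacian-sy (pathPotential a b p))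
      (cong (_+_ (b - a)) (sumFin-cong n λ i → cong (_-_ b) (pathPotential-lastInner a b p i)))

    pathNeighbours : ∀ a b p i j x → let t = toℕ j; step t′ = x - p i (ℕ.suc t′) in
      inners (λ u → if adj (inner i j) u then x - pathPotential a b p u else + 0)
      ≡ sumFin (ℕ.suc m) (λ j′ → if ℕ.suc t ℕ.≡ᵇ toℕ j′ then step (toℕ j′) else + 0)
        + sumFin (ℕ.suc m) (λ j′ → if t ℕ.≡ᵇ ℕ.suc (toℕ j′) then step (toℕ j′) else + 0)
    pathNeighbours a b p i j x = begin
      inners (λ u → if adj (inner i j) u then x - pathPotential a b p u else + 0)
        ≡⟨ sumFin-cong n (λ i′ → sumFin-cong (ℕ.suc m) (λ j′ →
             cong₂ (λ c d → if c ∧ d then x - p i′ (ℕ.suc (toℕ j′)) else + 0)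
                   (isYes≗does (i Fin.≟ i′))
                   (cong₂ _∨_ (isYes≗does (ℕ.suc t ℕ.≟ toℕ j′)) (isYes-≟-sym ℕ._≟_ (ℕ.suc (toℕ j′)) t)))) ⟩
      sumFin n (λ i′ → sumFin (ℕ.suc m) (λ j′ →
        if does (i Fin.≟ i′) ∧ onPath j′ then x - p i′ (ℕ.suc (toℕ j′)) else + 0))
        ≡⟨ sumFin-collapse i (λ c i′ → sumFin (ℕ.suc m) (λ j′ →
             if c ∧ onPath j′ then x - p i′ (ℕ.suc (toℕ j′)) else + 0)) (λ _ → sumFin-zero (ℕ.suc m)) ⟩
      sumFin (ℕ.suc m) (λ j′ → if onPath j′ then step (toℕ j′) else + 0)
        ≡⟨ sumFin-cong (ℕ.suc m) (λ j′ → if-∨-split (up j′) (down j′) (step (toℕ j′))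
                                                    (stepUp∧stepDown≡false t (toℕ j′))) ⟩
      sumFin (ℕ.suc m) (λ j′ → (if up j′ then step (toℕ j′) else + 0)
                              + (if down j′ then step (toℕ j′) else + 0))
        ≡⟨ sumFin-distrib-+ (ℕ.suc m) (λ j′ → if up j′ then step (toℕ j′) else + 0)
                                      (λ j′ → if down j′ then step (toℕ j′) else + 0) ⟩
      sumFin (ℕ.suc m) (λ j′ → if up j′ then step (toℕ j′) else + 0)
        + sumFin (ℕ.suc m) (λ j′ → if down j′ then step (toℕ j′) else + 0) ∎
      where
      open ≡-Reasoning
      t = toℕ j
      step : ℕ → ℤ
      step t′ = x - p i (ℕ.suc t′)
      up down onPath : Fin (ℕ.suc m) → Bool
      up     j′ = ℕ.suc t ℕ.≡ᵇ toℕ j′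
      down   j′ = t ℕ.≡ᵇ ℕ.suc (toℕ j′)
      onPath j′ = up j′ ∨ down j′

    -- The second difference of p along path i, plus corrections at the ends of the path where
    -- p i 0 and p i (m + 2) differ from the values a and b of the potential at x and y.
    laplacian-pathPotential-inner : ∀ a b p i j → let t = toℕ j; x = p i (ℕ.suc t) in
      laplacian (pathPotential a b p) (inner i j) ≡
        (x - p i t + indicator (t ℕ.≡ᵇ 0) * (p i 0 - a))
        + (x - p i (ℕ.suc (ℕ.suc t)) + indicator (t ℕ.≡ᵇ m) * (p i (ℕ.suc (ℕ.suc m)) - b))
    laplacian-pathPotential-inner a b p i j = begin
      (if ⌊ t ℕ.≟ 0 ⌋ then x - a else + 0) + (if ⌊ ℕ.suc t ℕ.≟ ℕ.suc m ⌋ then x - b else + 0)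
        + inners (λ u → if adj (inner i j) u then x - pathPotential a b p u else + 0)
        ≡⟨ cong₂ _+_ (cong₂ _+_ (cong (λ c → if c then x - a else + 0) (isYes≗does (t ℕ.≟ 0)))
                                (cong (λ c → if c then x - b else + 0) (isYes≗does (ℕ.suc t ℕ.≟ ℕ.suc m))))
                     (pathNeighbours a b p i j x) ⟩
      toX + toY + (up + down)      ≡⟨ regroup toX toY up down ⟩
      (toX + down) + (toY + up)
        ≡⟨ cong₂ _+_ (predecessorTerm t (p i) a x (ℕ.<⇒≤ t<1+m)) (successorTerm t (p i) b x t<1+m) ⟩
      (x - p i t + indicator (t ℕ.≡ᵇ 0) * (p i 0 - a))
        + (x - p i (ℕ.suc (ℕ.suc t)) + indicator (t ℕ.≡ᵇ m) * (p i (ℕ.suc (ℕ.suc m)) - b)) ∎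
      where
      open ≡-Reasoning
      t = toℕ j
      t<1+m = Fin.toℕ<n j
      x = p i (ℕ.suc t)
      toX toY up down : ℤ
      toX  = if t ℕ.≡ᵇ 0 then x - a else + 0
      toY  = if t ℕ.≡ᵇ m then x - b else + 0
      up   = sumFin (ℕ.suc m) (λ j′ → if ℕ.suc t ℕ.≡ᵇ toℕ j′ then x - p i (ℕ.suc (toℕ j′)) else + 0)
      down = sumFin (ℕ.suc m) (λ j′ → if t ℕ.≡ᵇ ℕ.suc (toℕ j′) then x - p i (ℕ.suc (toℕ j′)) else + 0)
      regroup : ∀ a b c d → a + b + (c + d) ≡ (a + d) + (b + c)
      regroup = solve-∀

    ℓ : ℕ
    ℓ = ℕ.suc (ℕ.suc m)

    descentAlong ascentAlong : Fin n → Fin n → ℕ → ℤ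
    descentAlong l i t = indicator (does (l Fin.≟ i)) * (+ ℓ - + t)
    ascentAlong  l i t = indicator (does (l Fin.≟ i)) * + t

    descent : HV n (ℕ.suc m) → ℤ
    descent = pathPotential (+ ℓ) (+ 0) (λ _ t → + ℓ - + t)

    pathDescent pathAscent : Fin n → HV n (ℕ.suc m) → ℤ
    pathDescent l = pathPotential (+ 0) (+ 0) (descentAlong l)
    pathAscent  l = pathPotential (+ 0) (+ 0) (ascentAlong l)

    laplacian-descent : ∀ v → laplacian descent v ≡ + (ℓ ℕ.+ n) * diff sx sy v
    laplacian-descent sx = trans (laplacian-sx descent)
      (trans (cong (_+_ (+ ℓ - + 0)) (trans (sumFin-cong n (λ _ → unitStep (+ ℓ))) (sumFin-const n (+ 1))))
             (collect (+ ℓ) (+ n)))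
      where
      unitStep : ∀ L → L - (L - + 1) ≡ + 1
      unitStep = solve-∀
      collect : ∀ L N → L - + 0 + N * + 1 ≡ (L + N) * (+ 1 - + 0)
      collect = solve-∀
    laplacian-descent sy = trans (laplacian-pathPotential-sy (+ ℓ) (+ 0) (λ _ t → + ℓ - + t))
      (trans (cong (_+_ (+ 0 - + ℓ)) (trans (sumFin-cong n (λ _ → unitStep (+ m))) (sumFin-const n -1ℤ)))
             (collect (+ ℓ) (+ n)))
      where
      unitStep : ∀ M → + 0 - (+ 2 + M - (+ 1 + M)) ≡ -1ℤ
      unitStep = solve-∀
      collect : ∀ L N → + 0 - L + N * -1ℤ ≡ (L + N) * (+ 0 - + 1)
      collect = solve-∀
    laplacian-descent (inner i j) = trans (laplacian-pathPotential-inner (+ ℓ) (+ 0) (λ _ t → + ℓ - + t) i j)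
      (affine (+ ℓ) (+ toℕ j) (indicator (toℕ j ℕ.≡ᵇ 0)) (indicator (toℕ j ℕ.≡ᵇ m)) (+ (ℓ ℕ.+ n)))
      where
      affine : ∀ L T c d Z →
        (L - (+ 1 + T) - (L - T) + c * (L - + 0 - L))
          + (L - (+ 1 + T) - (L - (+ 2 + T)) + d * (L - L - + 0)) ≡ Z * (+ 0 - + 0)
      affine = solve-∀

    laplacian-pathDescent : ∀ l v →
      laplacian (pathDescent l) v ≡ + ℓ * pt (firstInner l) v - + ℕ.suc m * pt sx v - pt sy v
    laplacian-pathDescent l sx = trans (laplacian-sx (pathDescent l))
      (trans (cong (_+_ (+ 0 - + 0))
                   (trans (sumFin-cong n (λ i → onPath (ι i) (+ ℓ))) (sumFin-indicator l (+ 1 - + ℓ))))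
             (collect (+ m)))
      where
      ι : Fin n → ℤ
      ι i = indicator (does (l Fin.≟ i))
      onPath : ∀ c L → + 0 - c * (L - + 1) ≡ c * (+ 1 - L)
      onPath = solve-∀
      collect : ∀ M → + 0 - + 0 + (+ 1 - (+ 2 + M)) ≡ (+ 2 + M) * + 0 - (+ 1 + M) * + 1 - + 0
      collect = solve-∀
    laplacian-pathDescent l sy = trans (laplacian-pathPotential-sy (+ 0) (+ 0) (descentAlong l))
      (trans (cong (_+_ (+ 0 - + 0))
                   (trans (sumFin-cong n (λ i → onPath (ι i) (+ m))) (sumFin-indicator l -1ℤ)))
             (collect (+ m)))
      where
      ι : Fin n → ℤ
      ι i = indicator (does (l Fin.≟ i))
      onPath : ∀ c M → + 0 - c * (+ 2 + M - (+ 1 + M)) ≡ c * -1ℤ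
      onPath = solve-∀
      collect : ∀ M → + 0 - + 0 + -1ℤ ≡ (+ 2 + M) * + 0 - (+ 1 + M) * + 0 - + 1
      collect = solve-∀
    laplacian-pathDescent l (inner i j) = trans
      (laplacian-pathPotential-inner (+ 0) (+ 0) (descentAlong l) i j)
      (trans (affine (+ ℓ) (+ toℕ j) (ι i) (indicator (toℕ j ℕ.≡ᵇ 0)) (indicator (toℕ j ℕ.≡ᵇ m)) (+ ℕ.suc m))
             (cong (λ x → + ℓ * x - + ℕ.suc m * + 0 - + 0)
                   (sym (trans (pt-inner l Fin.zero i j) (cong (λ c → ι i * indicator c) (isFirst j))))))
      where
      ι : Fin n → ℤ
      ι i = indicator (does (l Fin.≟ i))
      affine : ∀ L T c c₀ cₘ M →
        (c * (L - (+ 1 + T)) - c * (L - T) + c₀ * (c * (L - + 0) - + 0))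
          + (c * (L - (+ 1 + T)) - c * (L - (+ 2 + T)) + cₘ * (c * (L - L) - + 0))
        ≡ L * (c * c₀) - M * + 0 - + 0
      affine = solve-∀

    laplacian-pathAscent : ∀ l v →
      laplacian (pathAscent l) v ≡ + ℓ * pt (lastInner l) v - pt sx v - + ℕ.suc m * pt sy v
    laplacian-pathAscent l sx = trans (laplacian-sx (pathAscent l))
      (trans (cong (_+_ (+ 0 - + 0))
                   (trans (sumFin-cong n (λ i → onPath (ι i))) (sumFin-indicator l -1ℤ)))
             (collect (+ m)))
      where
      ι : Fin n → ℤ
      ι i = indicator (does (l Fin.≟ i))
      onPath : ∀ c → + 0 - c * + 1 ≡ c * -1ℤ
      onPath = solve-∀
      collect : ∀ M → + 0 - + 0 + -1ℤ ≡ (+ 2 + M) * + 0 - + 1 - (+ 1 + M) * + 0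
      collect = solve-∀
    laplacian-pathAscent l sy = trans (laplacian-pathPotential-sy (+ 0) (+ 0) (ascentAlong l))
      (trans (cong (_+_ (+ 0 - + 0))
                   (trans (sumFin-cong n (λ i → onPath (ι i) (+ m))) (sumFin-indicator l (- (+ 1 + + m)))))
             (collect (+ m)))
      where
      ι : Fin n → ℤ
      ι i = indicator (does (l Fin.≟ i))
      onPath : ∀ c M → + 0 - c * (+ 1 + M) ≡ c * - (+ 1 + M)
      onPath = solve-∀
      collect : ∀ M → + 0 - + 0 + - (+ 1 + M) ≡ (+ 2 + M) * + 0 - + 0 - (+ 1 + M) * + 1
      collect = solve-∀
    laplacian-pathAscent l (inner i j) = trans
      (laplacian-pathPotential-inner (+ 0) (+ 0) (ascentAlong l) i j)
      (trans (affine (+ ℓ) (+ toℕ j) (ι i) (indicator (toℕ j ℕ.≡ᵇ 0)) (indicator (toℕ j ℕ.≡ᵇ m)) (+ ℕ.suc m))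
             (cong (λ x → + ℓ * x - + 0 - + ℕ.suc m * + 0)
                   (sym (trans (pt-inner l (Fin.fromℕ m) i j) (cong (λ c → ι i * indicator c) (isLast j))))))
      where
      ι : Fin n → ℤ
      ι i = indicator (does (l Fin.≟ i))
      affine : ∀ L T c c₀ cₘ M →
        (c * (+ 1 + T) - c * T + c₀ * (c * + 0 - + 0))
          + (c * (+ 1 + T) - c * (+ 2 + T) + cₘ * (c * L - + 0))
        ≡ L * (c * cₘ) - + 0 - M * + 0
      affine = solve-∀

    εˣ-script εʸ-script : Fin n → HV n (ℕ.suc m) → ℤ
    εˣ-script l u = descent u - + (ℓ ℕ.+ n) * pathDescent l u
    εʸ-script l u = - descent u - + (ℓ ℕ.+ n) * pathAscent l u

    ηˣ-script ηʸ-script : Fin n → Fin n → HV n (ℕ.suc m) → ℤ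
    ηˣ-script l l′ u = pathDescent l u - pathDescent l′ u
    ηʸ-script l l′ u = pathAscent l u - pathAscent l′ u

    laplacian-εˣ-script : ∀ l v →
      laplacian (εˣ-script l) v ≡ + (ℓ ℕ.* (ℓ ℕ.+ n)) * diff sx (firstInner l) v
    laplacian-εˣ-script l v = begin
      laplacian (εˣ-script l) v
        ≡⟨ laplacian-linear (+ 1) (- Z) descent (pathDescent l) (εˣ-script l)
                            (λ u → combination (descent u) (pathDescent l u) Z) v ⟩
      + 1 * laplacian descent v + - Z * laplacian (pathDescent l) v
        ≡⟨ cong₂ (λ x y → + 1 * x + - Z * y) (laplacian-descent v) (laplacian-pathDescent l v) ⟩
      + 1 * (Z * (pt sx v - pt sy v))
        + - Z * (+ ℓ * pt (firstInner l) v - + ℕ.suc m * pt sx v - pt sy v)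
        ≡⟨ collect (+ m) (+ n) (pt sx v) (pt sy v) (pt (firstInner l) v) ⟩
      + ℓ * Z * diff sx (firstInner l) v
        ≡⟨ cong (_* diff sx (firstInner l) v) (pos-* ℓ (ℓ ℕ.+ n)) ⟨
      + (ℓ ℕ.* (ℓ ℕ.+ n)) * diff sx (firstInner l) v ∎
      where
      open ≡-Reasoning
      Z = + (ℓ ℕ.+ n)
      combination : ∀ x y Z → x - Z * y ≡ + 1 * x + - Z * y
      combination = solve-∀
      collect : ∀ M N px py pe →
        + 1 * ((+ 2 + M + N) * (px - py)) + - (+ 2 + M + N) * ((+ 2 + M) * pe - (+ 1 + M) * px - py)
        ≡ (+ 2 + M) * (+ 2 + M + N) * (px - pe)
      collect = solve-∀

    laplacian-εʸ-script : ∀ l v →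
      laplacian (εʸ-script l) v ≡ + (ℓ ℕ.* (ℓ ℕ.+ n)) * diff sy (lastInner l) v
    laplacian-εʸ-script l v = begin
      laplacian (εʸ-script l) v
        ≡⟨ laplacian-linear -1ℤ (- Z) descent (pathAscent l) (εʸ-script l)
                            (λ u → combination (descent u) (pathAscent l u) Z) v ⟩
      -1ℤ * laplacian descent v + - Z * laplacian (pathAscent l) v
        ≡⟨ cong₂ (λ x y → -1ℤ * x + - Z * y) (laplacian-descent v) (laplacian-pathAscent l v) ⟩
      -1ℤ * (Z * (pt sx v - pt sy v))
        + - Z * (+ ℓ * pt (lastInner l) v - pt sx v - + ℕ.suc m * pt sy v)
        ≡⟨ collect (+ m) (+ n) (pt sx v) (pt sy v) (pt (lastInner l) v) ⟩
      + ℓ * Z * diff sy (lastInner l) v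
        ≡⟨ cong (_* diff sy (lastInner l) v) (pos-* ℓ (ℓ ℕ.+ n)) ⟨
      + (ℓ ℕ.* (ℓ ℕ.+ n)) * diff sy (lastInner l) v ∎
      where
      open ≡-Reasoning
      Z = + (ℓ ℕ.+ n)
      combination : ∀ x y Z → - x - Z * y ≡ -1ℤ * x + - Z * y
      combination = solve-∀
      collect : ∀ M N px py pe →
        -1ℤ * ((+ 2 + M + N) * (px - py)) + - (+ 2 + M + N) * ((+ 2 + M) * pe - px - (+ 1 + M) * py)
        ≡ (+ 2 + M) * (+ 2 + M + N) * (py - pe)
      collect = solve-∀

    laplacian-ηˣ-script : ∀ l l′ v →
      laplacian (ηˣ-script l l′) v ≡ + ℓ * diff (firstInner l) (firstInner l′) v
    laplacian-ηˣ-script l l′ v = begin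
      laplacian (ηˣ-script l l′) v
        ≡⟨ laplacian-linear (+ 1) -1ℤ (pathDescent l) (pathDescent l′) (ηˣ-script l l′)
                            (λ u → combination (pathDescent l u) (pathDescent l′ u)) v ⟩
      + 1 * laplacian (pathDescent l) v + -1ℤ * laplacian (pathDescent l′) v
        ≡⟨ cong₂ (λ x y → + 1 * x + -1ℤ * y) (laplacian-pathDescent l v) (laplacian-pathDescent l′ v) ⟩
      + 1 * (+ ℓ * pt (firstInner l) v - + ℕ.suc m * pt sx v - pt sy v)
        + -1ℤ * (+ ℓ * pt (firstInner l′) v - + ℕ.suc m * pt sx v - pt sy v)
        ≡⟨ collect (+ ℓ) (+ ℕ.suc m) (pt sx v) (pt sy v) (pt (firstInner l) v) (pt (firstInner l′) v) ⟩
      + ℓ * diff (firstInner l) (firstInner l′) v ∎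
      where
      open ≡-Reasoning
      combination : ∀ x y → x - y ≡ + 1 * x + -1ℤ * y
      combination = solve-∀
      collect : ∀ L M px py pe pe′ →
        + 1 * (L * pe - M * px - py) + -1ℤ * (L * pe′ - M * px - py) ≡ L * (pe - pe′)
      collect = solve-∀

    laplacian-ηʸ-script : ∀ l l′ v →
      laplacian (ηʸ-script l l′) v ≡ + ℓ * diff (lastInner l) (lastInner l′) v
    laplacian-ηʸ-script l l′ v = begin
      laplacian (ηʸ-script l l′) v
        ≡⟨ laplacian-linear (+ 1) -1ℤ (pathAscent l) (pathAscent l′) (ηʸ-script l l′)
                            (λ u → combination (pathAscent l u) (pathAscent l′ u)) v ⟩
      + 1 * laplacian (pathAscent l) v + -1ℤ * laplacian (pathAscent l′) v
        ≡⟨ cong₂ (λ x y → + 1 * x + -1ℤ * y) (laplacian-pathAscent l v) (laplacian-pathAscent l′ v) ⟩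
      + 1 * (+ ℓ * pt (lastInner l) v - pt sx v - + ℕ.suc m * pt sy v)
        + -1ℤ * (+ ℓ * pt (lastInner l′) v - pt sx v - + ℕ.suc m * pt sy v)
        ≡⟨ collect (+ ℓ) (+ ℕ.suc m) (pt sx v) (pt sy v) (pt (lastInner l) v) (pt (lastInner l′) v) ⟩
      + ℓ * diff (lastInner l) (lastInner l′) v ∎
      where
      open ≡-Reasoning
      combination : ∀ x y → x - y ≡ + 1 * x + -1ℤ * y
      combination = solve-∀
      collect : ∀ L M px py pe pe′ →
        + 1 * (L * pe - px - M * py) + -1ℤ * (L * pe′ - px - M * py) ≡ L * (pe - pe′)
      collect = solve-∀

    -- Orders of δ, ε and η

    indicator-≟-≢ : ∀ {l l′ : Fin n} → l ≢ l′ → indicator (does (l Fin.≟ l′)) ≡ + 0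
    indicator-≟-≢ {l} {l′} l≢l′ = cong indicator (dec-false (l Fin.≟ l′) l≢l′)

    indicator-≟-refl : ∀ (l : Fin n) → indicator (does (l Fin.≟ l)) ≡ + 1
    indicator-≟-refl l = cong indicator (dec-true (l Fin.≟ l) refl)

    order-δ : Fin n → IsOrder (diff {n} {ℕ.suc m} sx sy) (ℓ ℕ.+ n)
    order-δ l = order-criterion descent (εˣ-script l) ℕ.z<s laplacian-descent (laplacian-εˣ-script l)
      λ z divides → ℕ.*-cancelˡ-∣ ℓ
        (subst (ℓ ℕ.* (ℓ ℕ.+ n) ℕ.∣_) (trans (cong (λ w → z ℕ.* ∣ w ∣) value) (ℕ.*-comm z ℓ)) divides)
      where
      value : ⟪ diff sx sy , εˣ-script l ⟫ ≡ + ℓ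
      value = trans (⟪diff,⟫ sx sy (εˣ-script l)) (evaluate (+ ℓ) (+ (ℓ ℕ.+ n)))
        where evaluate : ∀ L Z → L - Z * + 0 - (+ 0 - Z * + 0) ≡ L
              evaluate = solve-∀

    order-εˣ : (l l′ : Fin n) → l′ ≢ l → IsOrder (diff sx (firstInner l)) (ℓ ℕ.* (ℓ ℕ.+ n))
    order-εˣ l l′ l′≢l =
      order-criterion (εˣ-script l) (εˣ-script l′) ℕ.z<s (laplacian-εˣ-script l) (laplacian-εˣ-script l′)
        λ z divides → subst (ℓ ℕ.* (ℓ ℕ.+ n) ℕ.∣_) (trans (cong (λ w → z ℕ.* ∣ w ∣) value) (ℕ.*-identityʳ z)) divides
      where
      value : ⟪ diff sx (firstInner l) , εˣ-script l′ ⟫ ≡ + 1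
      value = begin
        ⟪ diff sx (firstInner l) , εˣ-script l′ ⟫
          ≡⟨ ⟪diff,⟫ sx (firstInner l) (εˣ-script l′) ⟩
        + ℓ - Z * + 0 - (+ ℓ - + 1 - Z * (indicator (does (l′ Fin.≟ l)) * (+ ℓ - + 1)))
          ≡⟨ cong (λ c → + ℓ - Z * + 0 - (+ ℓ - + 1 - Z * (c * (+ ℓ - + 1)))) (indicator-≟-≢ l′≢l) ⟩
        + ℓ - Z * + 0 - (+ ℓ - + 1 - Z * (+ 0 * (+ ℓ - + 1)))
          ≡⟨ evaluate (+ ℓ) Z ⟩
        + 1 ∎
        where
        open ≡-Reasoning
        Z = + (ℓ ℕ.+ n)
        evaluate : ∀ L Z → L - Z * + 0 - (L - + 1 - Z * (+ 0 * (L - + 1))) ≡ + 1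
        evaluate = solve-∀

    order-εʸ : (l l′ : Fin n) → l′ ≢ l → IsOrder (diff sy (lastInner l)) (ℓ ℕ.* (ℓ ℕ.+ n))
    order-εʸ l l′ l′≢l =
      order-criterion (εʸ-script l) (εʸ-script l′) ℕ.z<s (laplacian-εʸ-script l) (laplacian-εʸ-script l′)
        λ z divides → subst (ℓ ℕ.* (ℓ ℕ.+ n) ℕ.∣_) (trans (cong (λ w → z ℕ.* ∣ w ∣) value) (ℕ.*-identityʳ z)) divides
      where
      value : ⟪ diff sy (lastInner l) , εʸ-script l′ ⟫ ≡ + 1
      value = begin
        ⟪ diff sy (lastInner l) , εʸ-script l′ ⟫
          ≡⟨ ⟪diff,⟫ sy (lastInner l) (εʸ-script l′) ⟩
        - + 0 - Z * + 0 - (- descent (lastInner l) - Z * pathAscent l′ (lastInner l))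
          ≡⟨ cong₂ (λ x y → - + 0 - Z * + 0 - (- x - Z * y))
                   (pathPotential-lastInner (+ ℓ) (+ 0) (λ _ t → + ℓ - + t) l)
                   (trans (pathPotential-lastInner (+ 0) (+ 0) (ascentAlong l′) l)
                          (cong (_* + ℕ.suc m) (indicator-≟-≢ l′≢l))) ⟩
        - + 0 - Z * + 0 - (- (+ ℓ - + ℕ.suc m) - Z * (+ 0 * + ℕ.suc m))
          ≡⟨ evaluate (+ m) Z ⟩
        + 1 ∎
        where
        open ≡-Reasoning
        Z = + (ℓ ℕ.+ n)
        evaluate : ∀ M Z → - + 0 - Z * + 0 - (- (+ 2 + M - (+ 1 + M)) - Z * (+ 0 * (+ 1 + M))) ≡ + 1
        evaluate = solve-∀

    order-ηˣ : (l l′ : Fin n) → l ≢ l′ → IsOrder (diff (firstInner l) (firstInner l′)) ℓ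
    order-ηˣ l l′ l≢l′ =
      order-criterion (ηˣ-script l l′) (εˣ-script l) ℕ.z<s (laplacian-ηˣ-script l l′) (laplacian-εˣ-script l)
        λ z divides → [1+n]*o∣m*[o*n]⇒1+n∣m {o = ℓ ℕ.+ n} (subst (ℓ ℕ.* (ℓ ℕ.+ n) ℕ.∣_)
          (cong (z ℕ.*_) (trans (cong ∣_∣ value) (∣-i∣≡∣i∣ (+ ((ℓ ℕ.+ n) ℕ.* ℕ.suc m))))) divides)
      where
      value : ⟪ diff (firstInner l) (firstInner l′) , εˣ-script l ⟫ ≡ - + ((ℓ ℕ.+ n) ℕ.* ℕ.suc m)
      value = begin
        ⟪ diff (firstInner l) (firstInner l′) , εˣ-script l ⟫
          ≡⟨ ⟪diff,⟫ (firstInner l) (firstInner l′) (εˣ-script l) ⟩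
        + ℓ - + 1 - Z * (indicator (does (l Fin.≟ l)) * (+ ℓ - + 1))
          - (+ ℓ - + 1 - Z * (indicator (does (l Fin.≟ l′)) * (+ ℓ - + 1)))
          ≡⟨ cong₂ (λ c c′ → + ℓ - + 1 - Z * (c * (+ ℓ - + 1)) - (+ ℓ - + 1 - Z * (c′ * (+ ℓ - + 1))))
                   (indicator-≟-refl l) (indicator-≟-≢ l≢l′) ⟩
        + ℓ - + 1 - Z * (+ 1 * (+ ℓ - + 1)) - (+ ℓ - + 1 - Z * (+ 0 * (+ ℓ - + 1)))
          ≡⟨ evaluate (+ m) Z ⟩
        - (Z * + ℕ.suc m)
          ≡⟨ cong -_ (pos-* (ℓ ℕ.+ n) (ℕ.suc m)) ⟨
        - + ((ℓ ℕ.+ n) ℕ.* ℕ.suc m) ∎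
        where
        open ≡-Reasoning
        Z = + (ℓ ℕ.+ n)
        evaluate : ∀ M Z → + 2 + M - + 1 - Z * (+ 1 * (+ 2 + M - + 1))
                             - (+ 2 + M - + 1 - Z * (+ 0 * (+ 2 + M - + 1))) ≡ - (Z * (+ 1 + M))
        evaluate = solve-∀

    order-ηʸ : (l l′ : Fin n) → l ≢ l′ → IsOrder (diff (lastInner l) (lastInner l′)) ℓ
    order-ηʸ l l′ l≢l′ =
      order-criterion (ηʸ-script l l′) (εʸ-script l) ℕ.z<s (laplacian-ηʸ-script l l′) (laplacian-εʸ-script l)
        λ z divides → [1+n]*o∣m*[o*n]⇒1+n∣m {o = ℓ ℕ.+ n} (subst (ℓ ℕ.* (ℓ ℕ.+ n) ℕ.∣_)
          (cong (z ℕ.*_) (trans (cong ∣_∣ value) (∣-i∣≡∣i∣ (+ ((ℓ ℕ.+ n) ℕ.* ℕ.suc m))))) divides)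
      where
      Z = + (ℓ ℕ.+ n)
      atLastInner : ∀ i {c} → indicator (does (l Fin.≟ i)) ≡ c →
        εʸ-script l (lastInner i) ≡ - (+ ℓ - + ℕ.suc m) - Z * (c * + ℕ.suc m)
      atLastInner i refl = cong₂ (λ x y → - x - Z * y)
        (pathPotential-lastInner (+ ℓ) (+ 0) (λ _ t → + ℓ - + t) i)
        (pathPotential-lastInner (+ 0) (+ 0) (ascentAlong l) i)
      value : ⟪ diff (lastInner l) (lastInner l′) , εʸ-script l ⟫ ≡ - + ((ℓ ℕ.+ n) ℕ.* ℕ.suc m)
      value = begin
        ⟪ diff (lastInner l) (lastInner l′) , εʸ-script l ⟫
          ≡⟨ ⟪diff,⟫ (lastInner l) (lastInner l′) (εʸ-script l) ⟩
        εʸ-script l (lastInner l) - εʸ-script l (lastInner l′)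
          ≡⟨ cong₂ _-_ (atLastInner l (indicator-≟-refl l)) (atLastInner l′ (indicator-≟-≢ l≢l′)) ⟩
        - (+ ℓ - + ℕ.suc m) - Z * (+ 1 * + ℕ.suc m) - (- (+ ℓ - + ℕ.suc m) - Z * (+ 0 * + ℕ.suc m))
          ≡⟨ evaluate (+ m) Z ⟩
        - (Z * + ℕ.suc m)
          ≡⟨ cong -_ (pos-* (ℓ ℕ.+ n) (ℕ.suc m)) ⟨
        - + ((ℓ ℕ.+ n) ℕ.* ℕ.suc m) ∎
        where
        open ≡-Reasoning
        evaluate : ∀ M Z → - (+ 2 + M - (+ 1 + M)) - Z * (+ 1 * (+ 1 + M))
                             - (- (+ 2 + M - (+ 1 + M)) - Z * (+ 0 * (+ 1 + M))) ≡ - (Z * (+ 1 + M))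
        evaluate = solve-∀

    order-η : ∀ s → IsShared s → ∀ i i′ j j′ → i ≢ i′ →
      adj s (inner i j) ≡ true → adj s (inner i′ j′) ≡ true → IsOrder (diff (inner i j) (inner i′ j′)) ℓ
    order-η .sx (inj₁ refl) i i′ j j′ i≢i′ adjacent adjacent′
      rewrite adj-sx-inner⇒zero i adjacent | adj-sx-inner⇒zero i′ adjacent′ = order-ηˣ i i′ i≢i′
    order-η .sy (inj₂ refl) i i′ j j′ i≢i′ adjacent adjacent′
      rewrite adj-sy-inner⇒last i adjacent | adj-sy-inner⇒last i′ adjacent′ = order-ηʸ i i′ i≢i′

    order-ε : ∀ s → IsShared s → ∀ i j → adj s (inner i j) ≡ true → (l′ : Fin n) → l′ ≢ i →
      IsOrder (diff s (inner i j)) (ℓ ℕ.* (ℓ ℕ.+ n)) × IsOrder (diff (inner i j) s) (ℓ ℕ.* (ℓ ℕ.+ n))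
    order-ε .sx (inj₁ refl) i j adjacent l′ l′≢i rewrite adj-sx-inner⇒zero i adjacent =
      order , IsOrder-neg (diff-swap sx (firstInner i)) order
      where order = order-εˣ i l′ l′≢i
    order-ε .sy (inj₂ refl) i j adjacent l′ l′≢i rewrite adj-sy-inner⇒last i adjacent =
      order , IsOrder-neg (diff-swap sy (lastInner i)) order
      where order = order-εʸ i l′ l′≢i

open import Data.Nat using (_≤_; _+_; _*_; _∸_; suc; s≤s)

proposition3p2 : (k n : ℕ) → 3 ≤ k → 2 ≤ n →
    -- (iii) η : two non-shared neighbours of the same shared vertex on different cycles
    ((s : HV n (k ∸ 2)) → IsShared s → (i i' : Fin n) → (j j' : Fin (k ∸ 2)) → i ≢ i' →
      adj s (inner i j) ≡ true → adj s (inner i' j') ≡ true →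
      IsOrder (diff (inner i j) (inner i' j')) (k ∸ 1))
    -- (i) δ : the two shared vertices, in either order
    × IsOrder (diff {n} {k ∸ 2} sx sy) (k + n ∸ 1)
    × IsOrder (diff {n} {k ∸ 2} sy sx) (k + n ∸ 1)
    -- (ii) ε : a shared vertex and an adjacent non-shared vertex, in either order
    × ((s : HV n (k ∸ 2)) → IsShared s → (i : Fin n) → (j : Fin (k ∸ 2)) →
      adj s (inner i j) ≡ true →
      IsOrder (diff s (inner i j)) ((k ∸ 1) * (k + n ∸ 1))
      × IsOrder (diff (inner i j) s) ((k ∸ 1) * (k + n ∸ 1)))
proposition3p2 (suc (suc (suc m))) (suc (suc n)) (s≤s (s≤s (s≤s _))) (s≤s (s≤s _)) =
  order-η , order-δ Fin.zero , IsOrder-neg (diff-swap sx sy) (order-δ Fin.zero) ,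
  λ s shared i j adjacent →
    order-ε s shared i j adjacent (Fin.punchIn i Fin.zero) (Fin.punchInᵢ≢i i Fin.zero)
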